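{- The set $A_n=\{\langle 1,k,m\rangle: 1\le k\le m\le n-1\}$ is a minimal generating set for the semigroup $SUT_n$, and $$\mathrm{rank}(SUT_n)=|A_n|=\tfrac12 n(n-1).$$ Moreover, every $x\in SUT_n$ is a power of an element of $A_n$: $\mathbf{0}=\langle 1,1,1\rangle^2$, and $x=\langle 1,k,m+d-1\rangle^d$ for every $x=\langle d,k,m\rangle\in SUT_n\setminus\{\mathbf{0}\}$.
   Context: Fix an integer $n\ge 2$. For integers $d,k,m$ with $1-\min(0,d)\le k\le m\le n-\max(0,d)$, let $\langle d,k,m\rangle$ denote the $n\times n$ matrix with entries $x_{ij}$ ($i,j\in\{1,\dots,n\}$) equal to $1$ if $k\le i\le m$ and $j-i=d$, and $0$ otherwise. Let $\mathbf{0}$ be the $n\times n$ zero matrix and $SUT_n=\{\mathbf{0}\}\cup\{\langle d,k,m\rangle: d,k,m\in\mathbb{N},\ k\le m\le n-d\}$, a semigroup under matrix multiplication. A subset $A$ generates a finite semigroup $S$ if every element of $S$ is a finite product of elements of $A$; $A$ is a minimal generating set if no proper subset of $A$ generates $S$; and $\mathrm{rank}(S)=\min\{|A|: A\subseteq S \text{ generates } S\}$. -}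

module Defs where

open import Data.Nat using (ℕ; zero; suc; _+_; _*_; _∸_; _≤_; _≤ᵇ_; _≡ᵇ_)
open import Data.Nat.DivMod using (_/_)
open import Data.Fin using (Fin; toℕ)
import Data.Fin as F
open import Data.Bool using (if_then_else_; _∧_)
open import Data.List using (List; []; _∷_; length)
open import Data.List.Relation.Unary.All using (All)
open import Data.List.Relation.Unary.Any using (Any)
open import Data.List.Relation.Unary.AllPairs using (AllPairs)
open import Data.Product using (Σ; _×_; ∃; ∃-syntax)
open import Relation.Binary.PropositionalEquality using (_≡_)
open import Relation.Nullary using (¬_)

-- n×n matrices with natural-number entries; row/column index i : Fin n
-- stands for the paper's index toℕ i + 1 ∈ {1,…,n}.
Mat : ℕ → Set
Mat n = Fin n → Fin n → ℕ

_≈_ : ∀ {n} → Mat n → Mat n → Set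
x ≈ y = ∀ i j → x i j ≡ y i j

infix 4 _≈_

sumFin : ∀ {n} → (Fin n → ℕ) → ℕ
sumFin {zero} f = 0
sumFin {suc n} f = f F.zero + sumFin (λ i → f (F.suc i))

_⊗_ : ∀ {n} → Mat n → Mat n → Mat n
(x ⊗ y) i j = sumFin (λ l → x i l * y l j)

infixl 7 _⊗_

zeroM : ∀ {n} → Mat n
zeroM i j = 0

idM : ∀ {n} → Mat n
idM i j = if toℕ i ≡ᵇ toℕ j then 1 else 0

_^M_ : ∀ {n} → Mat n → ℕ → Mat n
x ^M zero = idM
x ^M suc e = x ⊗ (x ^M e)

⟨_,_,_⟩ : ∀ {n} → ℕ → ℕ → ℕ → Mat n
⟨ d , k , m ⟩ i j =
  if (k ≤ᵇ suc (toℕ i)) ∧ (suc (toℕ i) ≤ᵇ m) ∧ (suc (toℕ j) ≡ᵇ suc (toℕ i) + d)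
  then 1 else 0

-- membership in SUT_n (ℕ = {1,2,…}: d ≥ 1, k ≥ 1, k ≤ m ≤ n - d)
SUT : (n : ℕ) → Mat n → Set
SUT n x = (x ≈ zeroM) Data.Sum.⊎
  (∃[ d ] ∃[ k ] ∃[ m ] (1 ≤ d × 1 ≤ k × k ≤ m × m + d ≤ n × x ≈ ⟨ d , k , m ⟩))
  where import Data.Sum

A : (n : ℕ) → Mat n → Set
A n x = ∃[ k ] ∃[ m ] (1 ≤ k × k ≤ m × m + 1 ≤ n × x ≈ ⟨ 1 , k , m ⟩)

prod : ∀ {n} → Mat n → List (Mat n) → Mat n
prod x [] = x
prod x (y ∷ ys) = x ⊗ prod y ys

Generates : ∀ {n} → (Mat n → Set) → (Mat n → Set) → Set
Generates B S =
  (∀ x → B x → S x) ×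
  (∀ z → S z → ∃[ x ] ∃[ xs ] (B x × All B xs × prod x xs ≈ z))

-- B is a minimal generating set of S: B generates S and no proper subset of B
-- generates S (every generating C ⊆ B contains, up to ≈, all of B)
MinimalGenerating : ∀ {n} → (Mat n → Set) → (Mat n → Set) → Set₁
MinimalGenerating {n} B S =
  Generates B S ×
  ((C : Mat n → Set) → (∀ x → C x → B x) → Generates C S →
     ∀ x → B x → ∃[ y ] (C y × y ≈ x))

_∈≈_ : ∀ {n} → Mat n → List (Mat n) → Set
x ∈≈ L = Any (λ y → x ≈ y) L

Distinct : ∀ {n} → List (Mat n) → Set
Distinct = AllPairs (λ x y → ¬ (x ≈ y))

HasCard : ∀ {n} → (Mat n → Set) → ℕ → Set
HasCard {n} B r = ∃[ L ] (Distinct L × (∀ x → B x → x ∈≈ L) × All B L × length L ≡ r)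

-- rank(S) = r: some generating subset of S has r elements, and every generating
-- subset of S (finite, since S is) has at least r elements
RankIs : ∀ {n} → (Mat n → Set) → ℕ → Set
RankIs {n} S r =
  (∃[ L ] (Distinct L × Generates (λ x → x ∈≈ L) S × length L ≡ r)) ×
  (∀ (L : List (Mat n)) → Distinct L → Generates (λ x → x ∈≈ L) S → r ≤ length L)

-- The semigroup is graded by superdiagonals: a product of s elements of SUT_n vanishes below
-- its s-th superdiagonal, whereas ⟨ 1 , k , m ⟩ has a nonzero entry on the first one. So no
-- element of A_n is a product of two or more elements of SUT_n, and every generating set
-- contains A_n. Conversely, multiplying band matrices adds their offsets and intersects their
-- shifted row windows, which gives ⟨ d , k , m ⟩ = ⟨ 1 , k , m + d - 1 ⟩ ^ d. Counting the
-- pairwise distinct ⟨ 1 , k , m ⟩ gives |A_n| = n(n-1)/2.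
module Submission where

open import Defs
open import Data.Nat using (ℕ; zero; suc; z<s; _+_; _*_; _∸_; _≤_; _<_; _<?_; _≤ᵇ_; _≡ᵇ_; z≤n; s≤s)
open import Data.Nat.Properties
open import Data.Nat.DivMod using (_/_; m*n/n≡m)
open import Data.Bool using (Bool; true; false; T; if_then_else_; _∧_)
open import Data.Bool.Properties using (∧-assoc; ∧-zeroʳ; ∧-identityʳ; T-≡; T-∧)
open import Data.Fin using (Fin; toℕ; fromℕ<)
import Data.Fin as Fin
open import Data.Fin.Properties using (toℕ<n; toℕ-injective; toℕ-fromℕ<)
open import Data.Empty using (⊥-elim)
open import Data.Product using (_×_; _,_; proj₁; proj₂; ∃-syntax)
open import Data.Sum using (inj₁; inj₂)
open import Data.List using (List; []; _∷_; _++_; length; replicate; concat; applyDownFrom)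
open import Data.List.Properties using (length-++; length-applyDownFrom; length-removeAt′)
open import Data.List.Relation.Unary.All using (All; []; _∷_)
import Data.List.Relation.Unary.All as All
import Data.List.Relation.Unary.All.Properties as All
open import Data.List.Relation.Unary.Any using (here; there)
import Data.List.Relation.Unary.Any as Any
import Data.List.Relation.Unary.Any.Properties as Any
open import Data.List.Relation.Unary.AllPairs using ([]; _∷_)
import Data.List.Relation.Unary.AllPairs.Properties as AllPairs
open import Function using (_∘′_)
open import Function.Bundles using (_⇔_; mk⇔; Equivalence)
open import Level using (0ℓ)
open import Relation.Binary.Bundles using (Setoid)
open import Relation.Binary.PropositionalEquality
open import Relation.Nullary using (¬_; yes; no)

open Equivalence using (to; from)

module _ {c ℓ} (S : Setoid c ℓ) where
  open Setoid S using () renaming (_≈_ to _∼_; sym to ∼-sym; trans to ∼-trans)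
  open import Data.List.Membership.Setoid S using (_∈_)
  open import Data.List.Relation.Unary.Unique.Setoid S using (Unique)

  ∈-─ : ∀ {x y xs} (y∈xs : y ∈ xs) → ¬ y ∼ x → x ∈ xs → x ∈ (xs Any.─ y∈xs)
  ∈-─ (here y≈z)  y≉x (here x≈z)  = ⊥-elim (y≉x (∼-trans y≈z (∼-sym x≈z)))
  ∈-─ (here _)    _   (there x∈)  = x∈
  ∈-─ (there _)   _   (here x≈z)  = here x≈z
  ∈-─ (there y∈)  y≉x (there x∈)  = there (∈-─ y∈ y≉x x∈)

  Unique-⊆⇒length≤ : ∀ {xs ys} → Unique xs → All (_∈ ys) xs → length xs ≤ length ys
  Unique-⊆⇒length≤ []               []             = z≤n
  Unique-⊆⇒length≤ {ys = ys} (x≉xs ∷ u) (x∈ys ∷ xs⊆ys) =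
    subst (_ ≤_) (sym (length-removeAt′ ys (Any.index x∈ys)))
      (s≤s (Unique-⊆⇒length≤ u (All.zipWith (λ (x≉z , z∈ys) → ∈-─ x∈ys x≉z z∈ys) (x≉xs , xs⊆ys))))

𝟙 : Bool → ℕ
𝟙 b = if b then 1 else 0

𝟙-∧ : ∀ x y → 𝟙 (x ∧ y) ≡ 𝟙 x * 𝟙 y
𝟙-∧ true  y = sym (+-identityʳ (𝟙 y))
𝟙-∧ false y = refl

𝟙-injective : ∀ {x y} → 𝟙 x ≡ 𝟙 y → x ≡ y
𝟙-injective {true}  {true}  _ = refl
𝟙-injective {false} {false} _ = refl

0<𝟙⇒T : ∀ {x} → 0 < 𝟙 x → T x
0<𝟙⇒T {true} _ = _

T⇒𝟙≡1 : ∀ {x} → T x → 𝟙 x ≡ 1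
T⇒𝟙≡1 {true} _ = refl

T-injective : ∀ {x y} → (T x ⇔ T y) → x ≡ y
T-injective {true}  {true}  _   = refl
T-injective {true}  {false} x⇔y = ⊥-elim (to x⇔y _)
T-injective {false} {true}  x⇔y = ⊥-elim (from x⇔y _)
T-injective {false} {false} _   = refl

≡ᵇ-refl : ∀ m → (m ≡ᵇ m) ≡ true
≡ᵇ-refl m = to T-≡ (≡⇒≡ᵇ m m refl)

≢⇒≡ᵇ≡false : ∀ {m n} → m ≢ n → (m ≡ᵇ n) ≡ false
≢⇒≡ᵇ≡false {m} {n} m≢n with m ≡ᵇ n | ≡ᵇ⇒≡ m n
... | false | _        = refl
... | true  | m≡ᵇn⇒m≡n = ⊥-elim (m≢n (m≡ᵇn⇒m≡n _))

sumFin-cong : ∀ {n} {f g : Fin n → ℕ} → (∀ l → f l ≡ g l) → sumFin f ≡ sumFin g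
sumFin-cong {zero}  f≗g = refl
sumFin-cong {suc n} f≗g = cong₂ _+_ (f≗g Fin.zero) (sumFin-cong (λ l → f≗g (Fin.suc l)))

sumFin-zero : ∀ {n} {f : Fin n → ℕ} → (∀ l → f l ≡ 0) → sumFin f ≡ 0
sumFin-zero {zero}  f≗0 = refl
sumFin-zero {suc n} f≗0 = cong₂ _+_ (f≗0 Fin.zero) (sumFin-zero (λ l → f≗0 (Fin.suc l)))

-- The hypothesis allows c to lie outside Fin n provided the value is 0.
sumFin-point : ∀ {n} c v → (0 < v → c < n) → sumFin {n} (λ l → 𝟙 (toℕ l ≡ᵇ c) * v) ≡ v
sumFin-point {zero}  c       zero    _     = refl
sumFin-point {zero}  c       (suc v) c<0   with () ← c<0 z<s
sumFin-point {suc n} zero    v       _     =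
  trans (cong₂ _+_ (+-identityʳ v) (sumFin-zero {n} (λ _ → refl))) (+-identityʳ v)
sumFin-point {suc n} (suc c) v       c<1+n = sumFin-point c v (≤-pred ∘′ c<1+n)

Mat-setoid : ℕ → Setoid 0ℓ 0ℓ
Mat-setoid n = record
  { Carrier       = Mat n
  ; _≈_           = _≈_
  ; isEquivalence = record
    { refl  = λ _ _ → refl
    ; sym   = λ x≈y i j → sym (x≈y i j)
    ; trans = λ x≈y y≈z i j → trans (x≈y i j) (y≈z i j)
    }
  }

module _ {n : ℕ} where
  open Setoid (Mat-setoid n) public
    using () renaming (refl to ≈-refl; sym to ≈-sym; trans to ≈-trans)

⊗-cong : ∀ {n} {x x′ y y′ : Mat n} → x ≈ x′ → y ≈ y′ → x ⊗ y ≈ x′ ⊗ y′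
⊗-cong x≈x′ y≈y′ i j = sumFin-cong (λ l → cong₂ _*_ (x≈x′ i l) (y≈y′ l j))

⊗-identityʳ : ∀ {n} (x : Mat n) → x ⊗ idM ≈ x
⊗-identityʳ x i j =
  trans (sumFin-cong onlyColumnj) (sumFin-point (toℕ j) (x i j) (λ _ → toℕ<n j))
  where
  onlyColumnj : ∀ l → x i l * 𝟙 (toℕ l ≡ᵇ toℕ j) ≡ 𝟙 (toℕ l ≡ᵇ toℕ j) * x i j
  onlyColumnj l with l Fin.≟ j
  ... | yes refl = *-comm (x i l) _
  ... | no l≢j rewrite ≢⇒≡ᵇ≡false (l≢j ∘′ toℕ-injective) = *-zeroʳ (x i l)

prod-replicate : ∀ {n} (x : Mat n) e → prod x (replicate e x) ≈ x ^M suc e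
prod-replicate x zero    = ≈-sym (⊗-identityʳ x)
prod-replicate x (suc e) = ⊗-cong (≈-refl {x = x}) (prod-replicate x e)

band : ∀ {n} → (ℕ → Bool) → ℕ → Mat n
band P d i j = 𝟙 (P (toℕ i) ∧ (toℕ j ≡ᵇ toℕ i + d))

band-cong : ∀ {n} {P Q : ℕ → Bool} d → (∀ a → P a ≡ Q a) → band {n} P d ≈ band Q d
band-cong d P≗Q i j = cong (λ b → 𝟙 (b ∧ _)) (P≗Q (toℕ i))

𝟙-∧-≡ᵇ : ∀ p (q : ℕ → Bool) m c → 𝟙 (p ∧ (m ≡ᵇ c)) * 𝟙 (q m) ≡ 𝟙 (m ≡ᵇ c) * 𝟙 (p ∧ q c)
𝟙-∧-≡ᵇ p q m c with m ≟ c
... | yes refl rewrite ≡ᵇ-refl m | ∧-identityʳ p =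
  trans (sym (𝟙-∧ p (q m))) (sym (+-identityʳ _))
... | no m≢c rewrite ≢⇒≡ᵇ≡false m≢c | ∧-zeroʳ p = refl

band-⊗ : ∀ {n} P Q d₁ d₂ →
         band {n} P d₁ ⊗ band Q d₂ ≈ band (λ a → P a ∧ Q (a + d₁)) (d₁ + d₂)
band-⊗ {n} P Q d₁ d₂ i j = begin
  sumFin {n} (λ l → 𝟙 (P a ∧ (toℕ l ≡ᵇ a + d₁)) * 𝟙 (Q (toℕ l) ∧ (b ≡ᵇ toℕ l + d₂)))
    ≡⟨ sumFin-cong {n} (λ l → 𝟙-∧-≡ᵇ (P a) (λ c → Q c ∧ (b ≡ᵇ c + d₂)) (toℕ l) (a + d₁)) ⟩
  sumFin {n} (λ l → 𝟙 (toℕ l ≡ᵇ a + d₁) * v)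
    ≡⟨ sumFin-point {n} (a + d₁) v a+d₁<n ⟩
  v
    ≡⟨ cong 𝟙 (sym (∧-assoc (P a) (Q (a + d₁)) _)) ⟩
  𝟙 ((P a ∧ Q (a + d₁)) ∧ (b ≡ᵇ a + d₁ + d₂))
    ≡⟨ cong (λ c → 𝟙 ((P a ∧ Q (a + d₁)) ∧ (b ≡ᵇ c))) (+-assoc a d₁ d₂) ⟩
  𝟙 ((P a ∧ Q (a + d₁)) ∧ (b ≡ᵇ a + (d₁ + d₂))) ∎
  where
  open ≡-Reasoning
  a b v : ℕ
  a = toℕ i
  b = toℕ j
  v = 𝟙 (P a ∧ Q (a + d₁) ∧ (b ≡ᵇ a + d₁ + d₂))
  a+d₁<n : 0 < v → a + d₁ < n
  a+d₁<n 0<v = ≤-<-trans (≤-trans (m≤m+n (a + d₁) d₂) (≤-reflexive (sym b≡a+d₁+d₂))) (toℕ<n j)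
    where
    b≡a+d₁+d₂ : b ≡ a + d₁ + d₂
    b≡a+d₁+d₂ = ≡ᵇ⇒≡ b _ (proj₂ (to (T-∧ {Q (a + d₁)}) (proj₂ (to (T-∧ {P a}) (0<𝟙⇒T 0<v)))))

-- Row a is 0-indexed, so it is the paper's row a + 1.
window : ℕ → ℕ → ℕ → Bool
window k m a = (k ≤ᵇ suc a) ∧ (suc a ≤ᵇ m)

T-window : ∀ k m a → T (window k m a) ⇔ (k ≤ suc a × suc a ≤ m)
T-window k m a = mk⇔
  (λ w → let k≤ , ≤m = to (T-∧ {k ≤ᵇ suc a}) w in ≤ᵇ⇒≤ k (suc a) k≤ , ≤ᵇ⇒≤ (suc a) m ≤m)
  (λ (k≤ , ≤m) → from T-∧ (≤⇒≤ᵇ k≤ , ≤⇒≤ᵇ ≤m))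

⟨⟩≈band : ∀ {n} d k m → ⟨_,_,_⟩ {n} d k m ≈ band (window k m) d
⟨⟩≈band d k m i j = cong 𝟙 (sym (∧-assoc (k ≤ᵇ suc (toℕ i)) (suc (toℕ i) ≤ᵇ m) _))

window-shift : ∀ k {m M} → m < M → ∀ a → (window k M a ∧ window k (suc m) (a + 1)) ≡ window k m a
window-shift k {m} {M} m<M a rewrite +-comm a 1 = T-injective (mk⇔ narrow widen)
  where
  narrow : T (window k M a ∧ window k (suc m) (suc a)) → T (window k m a)
  narrow w with to (T-∧ {window k M a}) w
  ... | w₁ , w₂ = from (T-window k m a)
    (proj₁ (to (T-window k M a) w₁) , ≤-pred (proj₂ (to (T-window k (suc m) (suc a)) w₂)))
  widen : T (window k m a) → T (window k M a ∧ window k (suc m) (suc a))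
  widen w with to (T-window k m a) w
  ... | k≤1+a , 1+a≤m = from (T-∧ {window k M a})
    ( from (T-window k M a) (k≤1+a , <⇒≤ (≤-<-trans 1+a≤m m<M))
    , from (T-window k (suc m) (suc a)) (m≤n⇒m≤1+n k≤1+a , s≤s 1+a≤m))

-- The induction fixes the base ⟨ 1 , k , M ⟩ and lowers m as the exponent grows.
power-window : ∀ {n} k {M} e m → m + e ≡ M →
               prod (⟨_,_,_⟩ {n} 1 k M) (replicate e ⟨ 1 , k , M ⟩) ≈ ⟨ suc e , k , m ⟩
power-window k zero m refl rewrite +-identityʳ m = ≈-refl
power-window {n} k {M} (suc e) m m+1+e≡M = begin
  x ⊗ prod x (replicate e x)
    ≈⟨ ⊗-cong (≈-refl {x = x}) (power-window k e (suc m) (trans (sym (+-suc m e)) m+1+e≡M)) ⟩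
  x ⊗ ⟨ suc e , k , suc m ⟩
    ≈⟨ ⊗-cong (⟨⟩≈band 1 k M) (⟨⟩≈band (suc e) k (suc m)) ⟩
  band (window k M) 1 ⊗ band (window k (suc m)) (suc e)
    ≈⟨ band-⊗ (window k M) (window k (suc m)) 1 (suc e) ⟩
  band (λ a → window k M a ∧ window k (suc m) (a + 1)) (2 + e)
    ≈⟨ band-cong (2 + e) (window-shift k m<M) ⟩
  band (window k m) (2 + e)
    ≈⟨ ⟨⟩≈band (2 + e) k m ⟨
  ⟨ 2 + e , k , m ⟩ ∎
  where
  open import Relation.Binary.Reasoning.Setoid (Mat-setoid n)
  x : Mat n
  x = ⟨ 1 , k , M ⟩
  m<M : m < M
  m<M = subst (m <_) m+1+e≡M (≤-trans (s≤s (m≤m+n m e)) (≤-reflexive (sym (+-suc m e))))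

⟨⟩≈power : ∀ {n} e k m → ⟨_,_,_⟩ {n} (suc e) k m ≈ ⟨ 1 , k , m + e ⟩ ^M suc e
⟨⟩≈power e k m = ≈-trans (≈-sym (power-window k e m refl)) (prod-replicate _ e)

VanishesBelow : ∀ {n} → ℕ → Mat n → Set
VanishesBelow g x = ∀ i j → toℕ j < toℕ i + g → x i j ≡ 0

VanishesBelow-resp-≈ : ∀ {n g} {x y : Mat n} → x ≈ y → VanishesBelow g y → VanishesBelow g x
VanishesBelow-resp-≈ x≈y vy i j j<i+g = trans (x≈y i j) (vy i j j<i+g)

VanishesBelow-mono : ∀ {n g h} {x : Mat n} → g ≤ h → VanishesBelow h x → VanishesBelow g x
VanishesBelow-mono g≤h vx i j j<i+g = vx i j (<-≤-trans j<i+g (+-monoʳ-≤ (toℕ i) g≤h))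

VanishesBelow-⊗ : ∀ {n g h} {x y : Mat n} →
                  VanishesBelow g x → VanishesBelow h y → VanishesBelow (g + h) (x ⊗ y)
VanishesBelow-⊗ {g = g} {h} {x} {y} vx vy i j j<i+g+h = sumFin-zero term≡0
  where
  term≡0 : ∀ l → x i l * y l j ≡ 0
  term≡0 l with toℕ l <? toℕ i + g
  ... | yes l<i+g rewrite vx i l l<i+g = refl
  ... | no  l≮i+g = trans (cong (x i l *_) (vy l j j<l+h)) (*-zeroʳ (x i l))
    where
    j<l+h : toℕ j < toℕ l + h
    j<l+h = <-≤-trans j<i+g+h
      (≤-trans (≤-reflexive (sym (+-assoc (toℕ i) g h))) (+-monoˡ-≤ h (≮⇒≥ l≮i+g)))

band-vanishesBelow : ∀ {n} P d → VanishesBelow d (band {n} P d)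
band-vanishesBelow P d i j j<i+d rewrite ≢⇒≡ᵇ≡false (<⇒≢ j<i+d) | ∧-zeroʳ (P (toℕ i)) = refl

SUT⇒VanishesBelow1 : ∀ {n} {x : Mat n} → SUT n x → VanishesBelow 1 x
SUT⇒VanishesBelow1 (inj₁ x≈0) i j _ = x≈0 i j
SUT⇒VanishesBelow1 (inj₂ (d , k , m , 1≤d , _ , _ , _ , x≈⟨d,k,m⟩)) =
  VanishesBelow-resp-≈ (≈-trans x≈⟨d,k,m⟩ (⟨⟩≈band d k m))
    (VanishesBelow-mono 1≤d (band-vanishesBelow (window k m) d))

prod-vanishesBelow : ∀ {n} {x : Mat n} {xs} → VanishesBelow 1 x → All (VanishesBelow 1) xs →
                     VanishesBelow (suc (length xs)) (prod x xs)
prod-vanishesBelow vx []         = vx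
prod-vanishesBelow vx (vy ∷ vys) = VanishesBelow-⊗ vx (prod-vanishesBelow vy vys)

superdiagonalEntry : ∀ {n} → Mat n → (a : ℕ) → suc a < n → ℕ
superdiagonalEntry x a 1+a<n = x (fromℕ< (<-trans (n<1+n a) 1+a<n)) (fromℕ< 1+a<n)

superdiagonalEntry-vanishesBelow2 : ∀ {n} {x : Mat n} → VanishesBelow 2 x →
                                    ∀ a (1+a<n : suc a < n) → superdiagonalEntry x a 1+a<n ≡ 0
superdiagonalEntry-vanishesBelow2 vx a 1+a<n = vx _ _ (subst₂ _<_
  (sym (toℕ-fromℕ< 1+a<n)) (trans (+-comm 2 a) (cong (_+ 2) (sym (toℕ-fromℕ< _)))) ≤-refl)

⟨1⟩-superdiagonalEntry : ∀ {n} k m a (1+a<n : suc a < n) →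
                         superdiagonalEntry (⟨_,_,_⟩ {n} 1 k m) a 1+a<n ≡ 𝟙 (window k m a)
⟨1⟩-superdiagonalEntry k m a 1+a<n = trans (⟨⟩≈band 1 k m i j) (cong 𝟙 (begin
  window k m (toℕ i) ∧ (toℕ j ≡ᵇ toℕ i + 1)
    ≡⟨ cong₂ (λ r c → window k m r ∧ (c ≡ᵇ r + 1)) (toℕ-fromℕ< _) (toℕ-fromℕ< 1+a<n) ⟩
  window k m a ∧ (suc a ≡ᵇ a + 1)
    ≡⟨ cong (window k m a ∧_) (to T-≡ (≡⇒≡ᵇ (suc a) (a + 1) (+-comm 1 a))) ⟩
  window k m a ∧ true
    ≡⟨ ∧-identityʳ _ ⟩
  window k m a ∎))
  where
  open ≡-Reasoning
  i j : Fin _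
  i = fromℕ< (<-trans (n<1+n a) 1+a<n)
  j = fromℕ< 1+a<n

⟨1⟩-¬vanishesBelow2 : ∀ {n k m} → 1 ≤ k → k ≤ m → m < n → ¬ VanishesBelow 2 (⟨_,_,_⟩ {n} 1 k m)
⟨1⟩-¬vanishesBelow2 {k = suc r} {m} (s≤s z≤n) k≤m m<n v = 0≢1+n (begin
  0                                        ≡⟨ superdiagonalEntry-vanishesBelow2 v r 1+r<n ⟨
  superdiagonalEntry ⟨ 1 , suc r , m ⟩ r 1+r<n ≡⟨ ⟨1⟩-superdiagonalEntry (suc r) m r 1+r<n ⟩
  𝟙 (window (suc r) m r)                    ≡⟨ T⇒𝟙≡1 (from (T-window (suc r) m r) (≤-refl , k≤m)) ⟩
  1                                        ∎)
  where
  open ≡-Reasoning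
  1+r<n : suc r < _
  1+r<n = ≤-<-trans k≤m m<n

⟨1⟩-≈⇒window-⊆ : ∀ {n} k m k′ m′ a → suc a < n → ⟨_,_,_⟩ {n} 1 k m ≈ ⟨ 1 , k′ , m′ ⟩ →
                 k ≤ suc a × suc a ≤ m → k′ ≤ suc a × suc a ≤ m′
⟨1⟩-≈⇒window-⊆ k m k′ m′ a 1+a<n x≈y inWindow =
  to (T-window k′ m′ a) (subst T same-window (from (T-window k m a) inWindow))
  where
  same-window : window k m a ≡ window k′ m′ a
  same-window = 𝟙-injective (begin
    𝟙 (window k m a)                           ≡⟨ ⟨1⟩-superdiagonalEntry k m a 1+a<n ⟨
    superdiagonalEntry ⟨ 1 , k , m ⟩ a 1+a<n    ≡⟨ x≈y (fromℕ< (<-trans (n<1+n a) 1+a<n)) (fromℕ< 1+a<n) ⟩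
    superdiagonalEntry ⟨ 1 , k′ , m′ ⟩ a 1+a<n  ≡⟨ ⟨1⟩-superdiagonalEntry k′ m′ a 1+a<n ⟩
    𝟙 (window k′ m′ a)                         ∎)
    where open ≡-Reasoning

-- Compare the superdiagonal entries in the first and in the last row of the left-hand window.
⟨1⟩-≈⇒bounds : ∀ {n k m k′ m′} → k ≤ m → suc m < n →
               ⟨_,_,_⟩ {n} 1 (suc k) (suc m) ≈ ⟨ 1 , suc k′ , suc m′ ⟩ → k′ ≤ k × m ≤ m′
⟨1⟩-≈⇒bounds {k = k} {m} {k′} {m′} k≤m 1+m<n x≈y =
  ≤-pred (proj₁ (windows-⊆ k (≤-<-trans (s≤s k≤m) 1+m<n) (≤-refl , s≤s k≤m))) ,
  ≤-pred (proj₂ (windows-⊆ m 1+m<n (s≤s k≤m , ≤-refl)))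
  where
  windows-⊆ : ∀ a → suc a < _ → suc k ≤ suc a × suc a ≤ suc m → suc k′ ≤ suc a × suc a ≤ suc m′
  windows-⊆ a 1+a<n = ⟨1⟩-≈⇒window-⊆ (suc k) (suc m) (suc k′) (suc m′) a 1+a<n x≈y

⟨1⟩-injective : ∀ {n k m k′ m′} → k ≤ m → suc m < n → k′ ≤ m′ → suc m′ < n →
                ⟨_,_,_⟩ {n} 1 (suc k) (suc m) ≈ ⟨ 1 , suc k′ , suc m′ ⟩ → k ≡ k′ × m ≡ m′
⟨1⟩-injective k≤m 1+m<n k′≤m′ 1+m′<n x≈y
  with ⟨1⟩-≈⇒bounds k≤m 1+m<n x≈y | ⟨1⟩-≈⇒bounds k′≤m′ 1+m′<n (≈-sym x≈y)
... | k′≤k , m≤m′ | k≤k′ , m′≤m = ≤-antisym k≤k′ k′≤k , ≤-antisym m≤m′ m′≤m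

<⇒+1≤ : ∀ {m n} → m < n → m + 1 ≤ n
<⇒+1≤ {m} {n} = subst (_≤ n) (+-comm 1 m)

+1≤⇒< : ∀ {m n} → m + 1 ≤ n → m < n
+1≤⇒< {m} {n} = subst (_≤ n) (+-comm m 1)

⟨1⟩∈A : ∀ {n k m} → 1 ≤ k → k ≤ m → m < n → A n ⟨ 1 , k , m ⟩
⟨1⟩∈A {k = k} {m} 1≤k k≤m m<n = k , m , 1≤k , k≤m , <⇒+1≤ m<n , ≈-refl

A-resp-≈ : ∀ {n} {x y : Mat n} → x ≈ y → A n x → A n y
A-resp-≈ x≈y (k , m , 1≤k , k≤m , m+1≤n , x≈) = k , m , 1≤k , k≤m , m+1≤n , ≈-trans (≈-sym x≈y) x≈

A⊆SUT : ∀ {n} {x : Mat n} → A n x → SUT n x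
A⊆SUT (k , m , 1≤k , k≤m , m+1≤n , x≈) = inj₂ (1 , k , m , s≤s z≤n , 1≤k , k≤m , m+1≤n , x≈)

⟨⟩-empty : ∀ {n} d k → ⟨_,_,_⟩ {n} d k 0 ≈ zeroM
⟨⟩-empty d k i j = cong 𝟙 (∧-zeroʳ (k ≤ᵇ suc (toℕ i)))

Generates-⊇ : ∀ {n} {B C S : Mat n → Set} →
              (∀ x → B x → C x) → (∀ x → C x → S x) → Generates B S → Generates C S
Generates-⊇ B⊆C C⊆S (_ , gen) = C⊆S , λ z Sz →
  let x , xs , Bx , Bxs , prod≈z = gen z Sz
  in  x , xs , B⊆C x Bx , All.map (B⊆C _) Bxs , prod≈z

A-generates : ∀ {n} → 2 ≤ n → Generates (A n) (SUT n)
A-generates {n} 2≤n = (λ _ → A⊆SUT) , product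
  where
  product : ∀ z → SUT n z → ∃[ x ] ∃[ xs ] (A n x × All (A n) xs × prod x xs ≈ z)
  product z (inj₁ z≈0) =
    ⟨ 1 , 1 , 1 ⟩ , ⟨ 1 , 1 , 1 ⟩ ∷ [] , a , a ∷ [] ,
    ≈-trans (power-window 1 1 0 refl) (≈-trans (⟨⟩-empty 2 1) (≈-sym z≈0))
    where
    a : A n ⟨ 1 , 1 , 1 ⟩
    a = ⟨1⟩∈A ≤-refl ≤-refl 2≤n
  product z (inj₂ (suc e , k , m , _ , 1≤k , k≤m , m+d≤n , z≈)) =
    x , replicate e x , a , All.replicate⁺ e a ,
    ≈-trans (power-window k e m refl) (≈-sym z≈)
    where
    x : Mat n
    x = ⟨ 1 , k , m + e ⟩
    a : A n x
    a = ⟨1⟩∈A 1≤k (≤-trans k≤m (m≤m+n m e)) (subst (_≤ n) (+-suc m e) m+d≤n)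

A-indecomposable : ∀ {n} {z x : Mat n} {xs} → A n z →
                   VanishesBelow 1 x → All (VanishesBelow 1) xs → prod x xs ≈ z → x ≈ z
A-indecomposable _ _ [] x≈z = x≈z
A-indecomposable (k , m , 1≤k , k≤m , m+1≤n , z≈) vx (vy ∷ vys) prod≈z =
  ⊥-elim (⟨1⟩-¬vanishesBelow2 1≤k k≤m (+1≤⇒< m+1≤n)
    (VanishesBelow-resp-≈ (≈-sym (≈-trans prod≈z z≈))
      (VanishesBelow-mono (s≤s (s≤s z≤n)) (prod-vanishesBelow vx (vy ∷ vys)))))

A-indispensable : ∀ {n} {C : Mat n → Set} → Generates C (SUT n) →
                  ∀ {x} → A n x → ∃[ y ] (C y × y ≈ x)
A-indispensable {C = C} (C⊆SUT , gen) {x} Ax =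
  let y , ys , Cy , Cys , prod≈x = gen x (A⊆SUT Ax)
  in  y , Cy , A-indecomposable Ax (vanishes Cy) (All.map vanishes Cys) prod≈x
  where
  vanishes : ∀ {w} → C w → VanishesBelow 1 w
  vanishes {w} Cw = SUT⇒VanishesBelow1 (C⊆SUT w Cw)

⟨⟩-power-of-A : ∀ {n} d k m → 1 ≤ d → 1 ≤ k → k ≤ m → m + d ≤ n →
                A n ⟨ 1 , k , m + d ∸ 1 ⟩ × ⟨_,_,_⟩ {n} d k m ≈ ⟨ 1 , k , m + d ∸ 1 ⟩ ^M d
⟨⟩-power-of-A (suc e) k m _ 1≤k k≤m m+d≤n rewrite +-suc m e =
  ⟨1⟩∈A 1≤k (≤-trans k≤m (m≤m+n m e)) m+d≤n , ⟨⟩≈power e k m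

column : ∀ {n} → ℕ → List (Mat n)
column m = applyDownFrom (λ k → ⟨ 1 , suc k , suc m ⟩) (suc m)

generators : ∀ {n} → ℕ → List (Mat n)
generators M = concat (applyDownFrom column M)

length-generators : ∀ {n} M → length (generators {n} M) * 2 ≡ suc M * M
length-generators zero = refl
length-generators {n} (suc M) = begin
  length (column M ++ generators M) * 2
    ≡⟨ cong (_* 2) (length-++ (column {n} M)) ⟩
  (length (column {n} M) + length (generators {n} M)) * 2
    ≡⟨ cong (λ c → (c + length (generators {n} M)) * 2) (length-applyDownFrom _ (suc M)) ⟩
  (suc M + length (generators {n} M)) * 2
    ≡⟨ *-distribʳ-+ 2 (suc M) _ ⟩
  suc M * 2 + length (generators {n} M) * 2
    ≡⟨ cong (suc M * 2 +_) (length-generators M) ⟩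
  suc M * 2 + suc M * M
    ≡⟨ *-distribˡ-+ (suc M) 2 M ⟨
  suc M * (2 + M)
    ≡⟨ *-comm (suc M) (2 + M) ⟩
  (2 + M) * suc M ∎
  where open ≡-Reasoning

generators⊆A : ∀ M → All (A (suc M)) (generators M)
generators⊆A M = All.concat⁺ (All.applyDownFrom⁺₁ column M λ m<M →
  All.applyDownFrom⁺₁ _ _ λ k<1+m → ⟨1⟩∈A (s≤s z≤n) k<1+m (s≤s m<M))

A⊆generators : ∀ {M x} → A (suc M) x → x ∈≈ generators M
A⊆generators (suc k , suc m , s≤s z≤n , s≤s k≤m , m+1≤n , x≈) =
  Any.concat⁺ (Any.applyDownFrom⁺ column (Any.applyDownFrom⁺ _ x≈ (s≤s k≤m)) (≤-pred (+1≤⇒< m+1≤n)))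

generators-distinct : ∀ M → Distinct (generators {suc M} M)
generators-distinct M =
  AllPairs.concat⁺ (All.applyDownFrom⁺₁ column M column-distinct)
                   (AllPairs.applyDownFrom⁺₁ column M columns-disjoint)
  where
  column-distinct : ∀ {m} → m < M → Distinct (column m)
  column-distinct m<M = AllPairs.applyDownFrom⁺₁ _ _ λ k′<k k<1+m x≈y →
    <⇒≢ k′<k (sym (proj₁ (⟨1⟩-injective (≤-pred k<1+m) (s≤s m<M)
                                         (≤-pred (<-trans k′<k k<1+m)) (s≤s m<M) x≈y)))
  columns-disjoint : ∀ {m m′} → m′ < m → m < M →
                     All (λ x → All (λ y → ¬ x ≈ y) (column m′)) (column m)
  columns-disjoint m′<m m<M =
    All.applyDownFrom⁺₁ _ _ λ k<1+m → All.applyDownFrom⁺₁ _ _ λ k′<1+m′ x≈y →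
    <⇒≢ m′<m (sym (proj₂ (⟨1⟩-injective (≤-pred k<1+m) (s≤s m<M)
                                         (≤-pred k′<1+m′) (s≤s (<-trans m′<m m<M)) x≈y)))

rank-lowerBound : ∀ {M} (L : List (Mat (suc M))) → Generates (_∈≈ L) (SUT (suc M)) →
                  length (generators M) ≤ length L
rank-lowerBound {M} L gen = Unique-⊆⇒length≤ (Mat-setoid (suc M)) (generators-distinct M)
  (All.map (λ Ax → let y , y∈L , y≈x = A-indispensable gen Ax
                   in  Any.map (≈-trans (≈-sym y≈x)) y∈L)
           (generators⊆A M))

theorem15 : (n : ℕ) → 2 ≤ n →
    MinimalGenerating (A n) (SUT n)
    × RankIs (SUT n) (n * (n ∸ 1) / 2)
    × HasCard (A n) (n * (n ∸ 1) / 2)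
    × (zeroM {n} ≈ ⟨ 1 , 1 , 1 ⟩ ^M 2)
    × (∀ d k m → 1 ≤ d → 1 ≤ k → k ≤ m → m + d ≤ n →
         A n ⟨ 1 , k , m + d ∸ 1 ⟩ × ⟨_,_,_⟩ {n} d k m ≈ ⟨ 1 , k , m + d ∸ 1 ⟩ ^M d)
-- Minimality holds without the hypothesis C ⊆ A n: every generating set contains A n.
theorem15 (suc M) 2≤n =
    (A-generates 2≤n , λ _ _ gen _ → A-indispensable gen)
  , ( (generators M , generators-distinct M , generators-generate , |generators|)
    , λ L _ gen → subst (_≤ length L) |generators| (rank-lowerBound L gen))
  , (generators M , generators-distinct M , (λ _ → A⊆generators) , generators⊆A M , |generators|)
  , ≈-trans (≈-sym (⟨⟩-empty 2 1)) (⟨⟩≈power 1 1 0)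
  , ⟨⟩-power-of-A
  where
  |generators| : length (generators {suc M} M) ≡ suc M * M / 2
  |generators| = trans (sym (m*n/n≡m _ 2)) (cong (_/ 2) (length-generators M))
  generators-generate : Generates (_∈≈ generators M) (SUT (suc M))
  generators-generate = Generates-⊇ (λ _ → A⊆generators)
    (λ _ x∈ → A⊆SUT (All.lookupₛ (Mat-setoid (suc M)) A-resp-≈ (generators⊆A M) x∈))
    (A-generates 2≤n)
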